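{- Let $d\ge 1$ and let $\ell$ be a set of $2^d-1$ colors. If $c_A,c_B:\{0,1\}^d\to\ell$ are surjective labelings of the $d$-cube $\{0,1\}^d$, then there exists a sequence of surjective labelings $c_A=c_0,c_1,\dots,c_{2^{d+1}}=c_B$ of $\{0,1\}^d$ into $\ell$ such that each consecutive pair $c_t,c_{t+1}$ differs on at most one vertex of the cube. -}

module Defs where

open import Data.Nat using (ℕ; suc; _^_; _∸_; _+_)
open import Data.Bool using (Bool)
open import Data.Vec using (Vec)
open import Data.Fin using (Fin)
open import Data.Product using (∃)
open import Relation.Binary.PropositionalEquality using (_≡_; _≢_)

Cube : ℕ → Set
Cube d = Vec Bool d

Colours : ℕ → Set
Colours d = Fin (2 ^ d ∸ 1)

Labeling : ℕ → Set
Labeling d = Cube d → Colours d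

Surjective : ∀ {d} → Labeling d → Set
Surjective {d} c = (col : Colours d) → ∃ λ v → c v ≡ col

DifferAtMostOne : ∀ {d} → Labeling d → Labeling d → Set
DifferAtMostOne {d} c c' = ∃ λ (v : Cube d) → (w : Cube d) → w ≢ v → c w ≡ c' w

-- A surjective labeling of m + 1 vertices by m colours repeats exactly one colour, on a
-- single pair of vertices. Fix such a pair p, q of the target T; then T is injective away
-- from q. Recolour the vertices v ≠ q one by one to T v without disturbing those already
-- fixed: if v lies in the current repeated pair, recolour it at once; otherwise a vertex w
-- of that pair is not fixed yet (fixed vertices carry distinct colours), so first give w
-- the colour of v and then recolour v. A recoloured vertex always shares its colour with
-- another vertex, so surjectivity is never lost. After two steps per vertex, one last step
-- recolours q, giving 2m + 1 ≤ 2 ^ (d + 1) steps.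
module Submission where

open import Data.Fin using (Fin; zero; suc; fromℕ; inject₁; punchIn; punchOut; _≟_)
open import Data.Fin as F using ()
open import Data.Fin.Properties
  using (pigeonhole; <⇒≢; punchInᵢ≢i; punchIn-punchOut; punchOut-injective; injective⇒≤; 2↔Bool; *↔×)
open import Data.List using (List; []; _∷_; length; tabulate)
open import Data.List.Properties using (length-tabulate)
open import Data.List.Membership.Propositional using (_∈_; _∉_)
open import Data.List.Membership.Propositional.Properties using (∈-tabulate⁺)
open import Data.List.Relation.Unary.All as All using (All; []; _∷_)
open import Data.List.Relation.Unary.All.Properties using (tabulate⁺)
open import Data.List.Relation.Unary.Any using (any?)
open import Data.Nat using (ℕ; zero; suc; _+_; _*_; _^_; _∸_; _≥_)
open import Data.Nat.Properties using (n<1+n; 1+n≰n; +-comm; ^-distribˡ-+-*; m+[n∸m]≡n; m^n>0)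
open import Data.Product using (Σ; ∃; _×_; _,_; proj₁; proj₂)
open import Data.Product.Function.NonDependent.Propositional using (_×-↔_)
open import Data.Vec using (Vec; []; _∷_; uncons)
open import Data.Vec.Functional using (updateAt)
open import Data.Vec.Functional.Properties using (updateAt-updates; updateAt-minimal)
open import Function using (_∘_; const)
open import Function.Bundles using (Inverse; Surjection; _↔_; mk↔ₛ′)
open import Function.Definitions using (Injective; StrictlySurjective)
open import Function.Properties.Inverse using (↔-sym; ↔-trans; ↔⇒↠)
open import Relation.Binary.PropositionalEquality
open import Relation.Nullary using (yes; no; contradiction)

open import Defs

private
  variable
    A C V W : Set
    j k n : ℕ

Surj : (V → C) → Set
Surj = StrictlySurjective _≡_

∘-surjective : {h : W → V} {f : V → C} → Surj h → Surj f → Surj (f ∘ h)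
∘-surjective {f = f} h-surj f-surj y with f-surj y
... | v , fv≡y with h-surj v
...   | w , hw≡v = w , trans (cong f hw≡v) fv≡y

Adjacent : (f g : V → C) → Set
Adjacent f g = ∃ λ v → ∀ w → w ≢ v → f w ≡ g w

adjacent-refl : {f : V → C} → V → Adjacent f f
adjacent-refl v = v , λ _ _ → refl

data Path {V C : Set} : ℕ → (V → C) → (V → C) → Set where
  done : ∀ {f} → Surj f → Path zero f f
  step : ∀ {k f g h} → Surj f → Adjacent f g → Path k g h → Path (suc k) f h

last-surjective : ∀ {f g : V → C} → Path k f g → Surj g
last-surjective (done s) = s
last-surjective (step _ _ P) = last-surjective P

_++_ : ∀ {f g h : V → C} → Path k f g → Path j g h → Path (k + j) f h
done _ ++ Q = Q
step s a P ++ Q = step s a (P ++ Q)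

∘-adjacent : (e : W ↔ V) {f g : V → C} →
             Adjacent f g → Adjacent (f ∘ Inverse.to e) (g ∘ Inverse.to e)
∘-adjacent e (v , agree) = from v , λ w w≢from-v → agree (to w) (λ to-w≡v →
  w≢from-v (trans (sym (strictlyInverseʳ w)) (cong from to-w≡v)))
  where open Inverse e

∘-path : (e : W ↔ V) {f g : V → C} → Path k f g → Path k (f ∘ Inverse.to e) (g ∘ Inverse.to e)
∘-path e (done s) = done (∘-surjective (Surjection.strictlySurjective (↔⇒↠ e)) s)
∘-path e (step s a P) =
  step (∘-surjective (Surjection.strictlySurjective (↔⇒↠ e)) s) (∘-adjacent e a) (∘-path e P)

walk : ∀ {f g : V → C} → Path k f g → Fin (suc k) → V → C
walk {f = f} _ zero = f
walk (step _ _ P) (suc t) = walk P t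

walk-last : ∀ {f g : V → C} (P : Path k f g) → walk P (fromℕ k) ≡ g
walk-last (done _) = refl
walk-last (step _ _ P) = walk-last P

walk-surjective : ∀ {f g : V → C} (P : Path k f g) (t : Fin (suc k)) → Surj (walk P t)
walk-surjective (done s) zero = s
walk-surjective (step s _ _) zero = s
walk-surjective (step _ _ P) (suc t) = walk-surjective P t

walk-adjacent : ∀ {f g : V → C} (P : Path k f g) (t : Fin k) →
                Adjacent (walk P (inject₁ t)) (walk P (suc t))
walk-adjacent (step _ a _) zero = a
walk-adjacent (step _ _ P) (suc t) = walk-adjacent P t

updateAt-adjacent : (c : Fin n → A) (v : Fin n) (h : A → A) → Adjacent c (updateAt c v h)
updateAt-adjacent c v h = v , λ w w≢v → sym (updateAt-minimal w v c w≢v)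

updateAt-surjective : ∀ {c : Fin n → A} {v w} (h : A → A) →
                      Surj c → w ≢ v → c w ≡ c v → Surj (updateAt c v h)
updateAt-surjective {c = c} {v} {w} h c-surj w≢v cw≡cv y with c-surj y
... | u , cu≡y with u ≟ v
...   | no u≢v = u , trans (updateAt-minimal u v c u≢v) cu≡y
...   | yes refl = w , trans (updateAt-minimal w u c w≢v) (trans cw≡cv cu≡y)

-- A section of f avoiding b would inject Fin (suc n) into Fin n.
surjective⇒injective : {f : Fin n → Fin n} → Surj f → Injective _≡_ _≡_ f
surjective⇒injective {zero} _ {()}
surjective⇒injective {suc n} {f} f-surj {a} {b} fa≡fb with a ≟ b
... | yes a≡b = a≡b
... | no a≢b = contradiction (injective⇒≤ section-injective) 1+n≰n
  where
  preimage : ∀ y → ∃ λ x → b ≢ x × f x ≡ y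
  preimage y with f-surj y
  ... | x , fx≡y with x ≟ b
  ...   | no x≢b = x , x≢b ∘ sym , fx≡y
  ...   | yes refl = a , a≢b ∘ sym , trans fa≡fb fx≡y

  g : Fin (suc n) → Fin (suc n)
  g y = proj₁ (preimage y)

  b≢g : ∀ y → b ≢ g y
  b≢g y = proj₁ (proj₂ (preimage y))

  section : Fin (suc n) → Fin n
  section y = punchOut (b≢g y)

  section-injective : Injective _≡_ _≡_ section
  section-injective {y} {y′} eq = begin
    y         ≡⟨ sym (proj₂ (proj₂ (preimage y))) ⟩
    f (g y)   ≡⟨ cong f (punchOut-injective (b≢g y) (b≢g y′) eq) ⟩
    f (g y′)  ≡⟨ proj₂ (proj₂ (preimage y′)) ⟩
    y′        ∎
    where open ≡-Reasoning

module _ {m : ℕ} {T : Fin (suc m) → Fin m} (T-surjective : Surj T)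
         {p q : Fin (suc m)} (p≢q : p ≢ q) (Tp≡Tq : T p ≡ T q) where

  T∘punchIn-surjective : Surj (T ∘ punchIn q)
  T∘punchIn-surjective y with T-surjective y
  ... | u , Tu≡y with q ≟ u
  ...   | no q≢u = punchOut q≢u , trans (cong T (punchIn-punchOut q≢u)) Tu≡y
  ...   | yes refl =
          punchOut (p≢q ∘ sym) , trans (cong T (punchIn-punchOut (p≢q ∘ sym))) (trans Tp≡Tq Tu≡y)

  T-injective-off : ∀ {a b} → a ≢ q → b ≢ q → T a ≡ T b → a ≡ b
  T-injective-off {a} {b} a≢q b≢q Ta≡Tb = begin
    a                            ≡⟨ sym (punchIn-punchOut q≢a) ⟩
    punchIn q (punchOut q≢a)     ≡⟨ cong (punchIn q) (surjective⇒injective T∘punchIn-surjective T-eq) ⟩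
    punchIn q (punchOut q≢b)     ≡⟨ punchIn-punchOut q≢b ⟩
    b                            ∎
    where
    open ≡-Reasoning
    q≢a = a≢q ∘ sym
    q≢b = b≢q ∘ sym
    T-eq = trans (cong T (punchIn-punchOut q≢a)) (trans Ta≡Tb (sym (cong T (punchIn-punchOut q≢b))))

  Agrees : (Fin (suc m) → Fin m) → List (Fin (suc m)) → Set
  Agrees c R = All (λ u → c u ≡ T u) R

  updateAt-agrees : ∀ {c w R} (h : Fin m → Fin m) → w ∉ R → Agrees c R → Agrees (updateAt c w h) R
  updateAt-agrees {c} {w} h w∉R agree = All.tabulate λ {u} u∈R →
    trans (updateAt-minimal u w c λ { refl → w∉R u∈R }) (All.lookup agree u∈R)

  recolour-agrees : ∀ {c v R} → Agrees c R → Agrees (updateAt c v (const (T v))) (v ∷ R)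
  recolour-agrees {c} {v} agree = updateAt-updates v c ∷ All.map still-agrees agree
    where
    still-agrees : ∀ {u} → c u ≡ T u → updateAt c v (const (T v)) u ≡ T u
    still-agrees {u} cu≡Tu with u ≟ v
    ... | yes refl = updateAt-updates u c
    ... | no u≢v = trans (updateAt-minimal u v c u≢v) cu≡Tu

  -- The two ways, described in the header, of recolouring v to T v while keeping R fixed.
  data Repair (c : Fin (suc m) → Fin m) (v : Fin (suc m)) (R : List (Fin (suc m))) : Set where
    at-once : ∀ {w} → w ≢ v → c w ≡ c v → Repair c v R
    via     : ∀ {w w′} → w ∉ R → w ≢ v → w′ ≢ w → c w′ ≡ c w → Repair c v R

  repair? : ∀ {c} v {R} → All (_≢ q) R → Agrees c R → Repair c v R
  repair? {c} v {R} R≢q agree with pigeonhole (n<1+n m) c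
  ... | a , b , a<b , ca≡cb with a ≟ v | b ≟ v | any? (a ≟_) R | any? (b ≟_) R
  ... | yes refl | _ | _ | _ = at-once (a≢b ∘ sym) (sym ca≡cb)
    where a≢b = <⇒≢ a<b
  ... | no _ | yes refl | _ | _ = at-once (<⇒≢ a<b) ca≡cb
  ... | no a≢v | no _ | no a∉R | _ = via a∉R a≢v (<⇒≢ a<b ∘ sym) (sym ca≡cb)
  ... | no _ | no b≢v | yes _ | no b∉R = via b∉R b≢v (<⇒≢ a<b) ca≡cb
  ... | no _ | no _ | yes a∈R | yes b∈R = contradiction
    (T-injective-off (All.lookup R≢q a∈R) (All.lookup R≢q b∈R)
      (trans (sym (All.lookup agree a∈R)) (trans ca≡cb (All.lookup agree b∈R))))
    (<⇒≢ a<b)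

  repair : ∀ {c} v R → All (_≢ q) R → Surj c → Agrees c R →
           ∃ λ c′ → Path 2 c c′ × Agrees c′ (v ∷ R)
  repair {c} v R R≢q c-surj agree with repair? v R≢q agree
  ... | at-once w≢v cw≡cv =
        c′ , step c-surj (updateAt-adjacent c v _) (step c′-surj (adjacent-refl v) (done c′-surj))
           , recolour-agrees agree
    where
    c′ = updateAt c v (const (T v))
    c′-surj = updateAt-surjective _ c-surj w≢v cw≡cv
  ... | via {w} w∉R w≢v w′≢w cw′≡cw =
        c₂ , step c-surj (updateAt-adjacent c w _)
               (step c₁-surj (updateAt-adjacent c₁ v _) (done c₂-surj))
           , recolour-agrees (updateAt-agrees _ w∉R agree)
    where
    c₁ = updateAt c w (const (c v))
    c₁-surj = updateAt-surjective _ c-surj w′≢w cw′≡cw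
    c₁w≡c₁v : c₁ w ≡ c₁ v
    c₁w≡c₁v = trans (updateAt-updates w c) (sym (updateAt-minimal v w c (w≢v ∘ sym)))
    c₂ = updateAt c₁ v (const (T v))
    c₂-surj = updateAt-surjective _ c₁-surj w≢v c₁w≡c₁v

  repair-all : ∀ {c} R → All (_≢ q) R → Surj c → ∃ λ c′ → Path (length R * 2) c c′ × Agrees c′ R
  repair-all {c} [] _ c-surj = c , done c-surj , []
  repair-all {c} (v ∷ R) (_ ∷ R≢q) c-surj with repair-all R R≢q c-surj
  ... | c₁ , P , agree₁ with repair v R R≢q (last-surjective P) agree₁
  ...   | c₂ , Q , agree₂ = c₂ , subst (λ k → Path k c c₂) (+-comm (length R * 2) 2) (P ++ Q) , agree₂

  others : List (Fin (suc m))
  others = tabulate (punchIn q)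

  ∈-others : ∀ {w} → w ≢ q → w ∈ others
  ∈-others w≢q = subst (_∈ others) (punchIn-punchOut (w≢q ∘ sym)) (∈-tabulate⁺ _)

  -- The idle first step pads the 2m + 1 recolourings to 2(m + 1).
  reconfigure : ∀ {f} → Surj f → Path (suc m * 2) f T
  reconfigure {f} f-surj with repair-all others (tabulate⁺ (punchInᵢ≢i q)) f-surj
  ... | c , P , agree = step f-surj (adjacent-refl q) (subst (λ k → Path k f T) length≡ (P ++ finish))
    where
    finish : Path 1 c T
    finish = step (last-surjective P) (q , λ w w≢q → All.lookup agree (∈-others w≢q)) (done T-surjective)
    length≡ : length others * 2 + 1 ≡ suc (m * 2)
    length≡ = trans (cong (λ k → k * 2 + 1) (length-tabulate (punchIn q))) (+-comm (m * 2) 1)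

reconfiguration : ∀ {m} {f g : Fin (suc m) → Fin m} → Surj f → Surj g → Path (suc m * 2) f g
reconfiguration {m} {g = g} f-surj g-surj with pigeonhole (n<1+n m) g
... | p , q , p<q , gp≡gq = reconfigure g-surj (<⇒≢ p<q) gp≡gq f-surj

uncons↔ : Vec A (suc n) ↔ (A × Vec A n)
uncons↔ = mk↔ₛ′ uncons (λ (x , xs) → x ∷ xs) (λ _ → refl) λ { (x ∷ xs) → refl }

Cube↔Fin : ∀ d → Cube d ↔ Fin (2 ^ d)
Cube↔Fin zero = mk↔ₛ′ (const zero) (const []) (λ { zero → refl }) (λ { [] → refl })
Cube↔Fin (suc d) =
  ↔-trans uncons↔ (↔-trans (↔-sym 2↔Bool ×-↔ Cube↔Fin d) (↔-sym (*↔× {2} {2 ^ d})))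

2^d≡1+[2^d∸1] : ∀ d → 2 ^ d ≡ suc (2 ^ d ∸ 1)
2^d≡1+[2^d∸1] d = sym (m+[n∸m]≡n (m^n>0 2 d))

lemma3p1 : (d : ℕ) → d ≥ 1 → (cA cB : Labeling d) → Surjective cA → Surjective cB →
    Σ (Fin (suc (2 ^ (d + 1))) → Labeling d) λ c →
      ((t : Fin (suc (2 ^ (d + 1)))) → Surjective (c t))
      × ((v : Cube d) → c zero v ≡ cA v)
      × ((v : Cube d) → c (fromℕ (2 ^ (d + 1))) v ≡ cB v)
      × ((t : Fin (2 ^ (d + 1))) → DifferAtMostOne (c (inject₁ t)) (c (F.suc t)))
lemma3p1 d _ cA cB cA-surj cB-surj =
  walk P , walk-surjective P , (λ v → cong cA (strictlyInverseʳ v))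
  , (λ v → trans (cong-app (walk-last P) v) (cong cB (strictlyInverseʳ v))) , walk-adjacent P
  where
  Cube↔Vertices : Cube d ↔ Fin (suc (2 ^ d ∸ 1))
  Cube↔Vertices = subst (λ n → Cube d ↔ Fin n) (2^d≡1+[2^d∸1] d) (Cube↔Fin d)
  open Inverse Cube↔Vertices
  from-surjective : Surj from
  from-surjective = Surjection.strictlySurjective (↔⇒↠ (↔-sym Cube↔Vertices))
  length≡ : suc (2 ^ d ∸ 1) * 2 ≡ 2 ^ (d + 1)
  length≡ = trans (cong (_* 2) (sym (2^d≡1+[2^d∸1] d))) (sym (^-distribˡ-+-* 2 d 1))
  P : Path (2 ^ (d + 1)) (cA ∘ from ∘ to) (cB ∘ from ∘ to)
  P = subst (λ k → Path k (cA ∘ from ∘ to) (cB ∘ from ∘ to)) length≡ (∘-path Cube↔Vertices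
        (reconfiguration (∘-surjective from-surjective cA-surj) (∘-surjective from-surjective cB-surj)))
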